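{- Let $K=\mathbb{Q}(A,B,C,q)$ be the rational function field in indeterminates $A,B,C,q$ and set $D:=A$. Then for every admissible word $w$, $L_q(w)=L_q(\tau(w))$ in $K$.
   Context: Words: $W$ is the set of finite words in the six formal letters $e_{AB},e_{AC},e_{AD},e_{BC},e_{BD},e_{CD}$ (formal symbols, distinct even though $D=A$); a letter $e_{uv}$ has first entry $u$ and second entry $v$. $\tau:W\to W$ is the anti-automorphism with $\tau(e_{AB})=e_{CD}$, $\tau(e_{AC})=e_{BD}$, $\tau(e_{AD})=e_{AD}$, $\tau(e_{BC})=e_{BC}$, $\tau(e_{BD})=e_{AC}$, $\tau(e_{CD})=e_{AB}$. A word is admissible if it does not begin with $e_{AB},e_{AC},e_{AD}$ and does not end with $e_{AD},e_{BD},e_{CD}$. $q$-integrals: for $x,y\in K^\times$ write $x\trianglelefteq y$ iff $y/x\in\{q^{ -n}\mid n\geq0\}$; $I_q(x;[u_1,v_1],\dots,[u_k,v_k];y):=\sum_{x\trianglelefteq t_1\trianglelefteq\cdots\trianglelefteq t_k\trianglelefteq y}\prod_j\left(\frac{t_j}{t_j-u_j}-\frac{t_j}{t_j-v_j}\right)$. When $x=y=A$ the sum has the single term $t_1=\cdots=t_k=A$. Functional: for $w=e_{u_1v_1}\cdots e_{u_kv_k}$ and $1\leq j\leq k$ put $A^{(j)}:=Aq^{\#\{h\leq j\mid u_hv_h\in\{BC,BD,CD\}\}}$, $B^{(j)}:=Bq^{\#\{h\leq j\mid u_hv_h\notin\{AC,AD\}\}+\#\{h\geq j\mid u_hv_h=CD\}}$,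 $C^{(j)}:=Cq^{\#\{h\leq j\mid u_hv_h\notin\{AB,AD\}\}+\#\{h\geq j\mid u_hv_h=BD\}}$, $D^{(j)}:=Dq^{ -\#\{h\geq j\mid u_hv_h\in\{AB,AC,BC\}\}}$, and $L_q(w):=I_q(A;[u_1^{(1)},v_1^{(1)}],\dots,[u_k^{(k)},v_k^{(k)}];D)$, where $u_j^{(j)}$ denotes $X^{(j)}$ for the parameter $X\in\{A,B,C,D\}$ named by $u_j$ (similarly $v_j^{(j)}$); for admissible $w$ all terms are defined. This is the case $N=0$ of the relation $A=q^ND$. -}

module Defs where

open import Data.Nat using (ℕ; zero; suc; _∸_) renaming (_+_ to _+ℕ_)
open import Data.Integer using (ℤ; +_; -[1+_]; -_) renaming (_+_ to _+ℤ_; _*_ to _*ℤ_)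
open import Data.Bool using (Bool; true; false; not; _∨_)
open import Data.List using (List; []; _∷_; reverse; map; take; drop; filter; length)
open import Data.Product using (_×_; _,_)
open import Data.Unit using (⊤)
open import Data.Bool using (T)

-- The polynomial ring ℤ[A,B,C,q] as the free commutative ring on the
-- four indeterminates: term algebra modulo the commutative-ring laws.

data Var : Set where
  vA vB vC vq : Var

infixl 6 _⊕_
infixl 7 _⊗_
infix 4 _≋_

data Expr : Set where
  var  : Var → Expr
  con  : ℤ → Expr
  _⊕_  : Expr → Expr → Expr
  _⊗_  : Expr → Expr → Expr
  ⊝_   : Expr → Expr

data _≋_ : Expr → Expr → Set where
  ≋-refl  : ∀ {x} → x ≋ x
  ≋-sym   : ∀ {x y} → x ≋ y → y ≋ x
  ≋-trans : ∀ {x y z} → x ≋ y → y ≋ z → x ≋ z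
  ⊕-cong  : ∀ {x x′ y y′} → x ≋ x′ → y ≋ y′ → x ⊕ y ≋ x′ ⊕ y′
  ⊗-cong  : ∀ {x x′ y y′} → x ≋ x′ → y ≋ y′ → x ⊗ y ≋ x′ ⊗ y′
  ⊝-cong  : ∀ {x y} → x ≋ y → ⊝ x ≋ ⊝ y
  ⊕-assoc : ∀ x y z → (x ⊕ y) ⊕ z ≋ x ⊕ (y ⊕ z)
  ⊕-comm  : ∀ x y → x ⊕ y ≋ y ⊕ x
  ⊕-idˡ   : ∀ x → con (+ 0) ⊕ x ≋ x
  ⊝-invˡ  : ∀ x → (⊝ x) ⊕ x ≋ con (+ 0)
  ⊗-assoc : ∀ x y z → (x ⊗ y) ⊗ z ≋ x ⊗ (y ⊗ z)
  ⊗-comm  : ∀ x y → x ⊗ y ≋ y ⊗ x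
  ⊗-idˡ   : ∀ x → con (+ 1) ⊗ x ≋ x
  distribʳ : ∀ x y z → (y ⊕ z) ⊗ x ≋ (y ⊗ x) ⊕ (z ⊗ x)
  con-+   : ∀ a b → con (a +ℤ b) ≋ con a ⊕ con b
  con-*   : ∀ a b → con (a *ℤ b) ≋ con a ⊗ con b
  con-neg : ∀ a → con (- a) ≋ ⊝ con a

_⊖_ : Expr → Expr → Expr
x ⊖ y = x ⊕ (⊝ y)

_^^_ : Expr → ℕ → Expr
x ^^ zero  = con (+ 1)
x ^^ suc n = x ⊗ (x ^^ n)

-- The field K = Q(A,B,C,q) = Frac(ℤ[A,B,C,q]): formal fractions num/den,
-- with equality by cross multiplication.

record Frac : Set where
  constructor _//_
  field
    num : Expr
    den : Expr
open Frac public

infix 4 _≈K_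
_≈K_ : Frac → Frac → Set
f ≈K g = num f ⊗ den g ≋ num g ⊗ den f

embed : Expr → Frac
embed x = x // con (+ 1)

oneK : Frac
oneK = embed (con (+ 1))

_-K_ : Frac → Frac → Frac
(a // b) -K (c // d) = ((a ⊗ d) ⊖ (c ⊗ b)) // (b ⊗ d)

_*K_ : Frac → Frac → Frac
(a // b) *K (c // d) = (a ⊗ c) // (b ⊗ d)

_/K_ : Frac → Frac → Frac
(a // b) /K (c // d) = (a ⊗ d) // (b ⊗ c)

qpow : ℤ → Frac
qpow (+ n)     = (var vq ^^ n) // con (+ 1)
qpow -[1+ n ]  = con (+ 1) // (var vq ^^ suc n)

data Letter : Set where
  eAB eAC eAD eBC eBD eCD : Letter

Word : Set
Word = List Letter

τL : Letter → Letter
τL eAB = eCD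
τL eAC = eBD
τL eAD = eAD
τL eBC = eBC
τL eBD = eAC
τL eCD = eAB

-- τ is the anti-automorphism extending τL
τ : Word → Word
τ w = reverse (map τL w)

badFirst : Letter → Bool
badFirst eAB = true
badFirst eAC = true
badFirst eAD = true
badFirst _   = false

badLast : Letter → Bool
badLast eAD = true
badLast eBD = true
badLast eCD = true
badLast _   = false

lastOf : Letter → List Letter → Letter
lastOf x []       = x
lastOf x (y ∷ ys) = lastOf y ys

Admissible : Word → Set
Admissible []       = ⊤
Admissible (x ∷ xs) = T (not (badFirst x)) × T (not (badLast (lastOf x xs)))

-- The functional L_q (case x = y = A, i.e. D = A, N = 0)

data Param : Set where
  pA pB pC pD : Param

first second : Letter → Param
first eAB = pA
first eAC = pA
first eAD = pA
first eBC = pB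
first eBD = pB
first eCD = pC
second eAB = pB
second eAC = pC
second eAD = pD
second eBC = pC
second eBD = pD
second eCD = pD

count : (Letter → Bool) → List Letter → ℕ
count P xs = length (filter (λ x → T? (P x)) xs)
  where
  open import Relation.Nullary using (Dec; yes; no)
  T? : (b : Bool) → Dec (T b)
  T? true  = yes _
  T? false = no (λ ())

isBC-BD-CD notAC-AD notAB-AD isCD isBD isAB-AC-BC : Letter → Bool
isBC-BD-CD eBC = true
isBC-BD-CD eBD = true
isBC-BD-CD eCD = true
isBC-BD-CD _   = false
notAC-AD eAC = false
notAC-AD eAD = false
notAC-AD _   = true
notAB-AD eAB = false
notAB-AD eAD = false
notAB-AD _   = true
isCD eCD = true
isCD _   = false
isBD eBD = true
isBD _   = false
isAB-AC-BC eAB = true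
isAB-AC-BC eAC = true
isAB-AC-BC eBC = true
isAB-AC-BC _   = false

-- #{h ≤ j | P(w_h)} and #{h ≥ j | P(w_h)}, positions 1-indexed
upto from : (Letter → Bool) → Word → ℕ → ℕ
upto P w j = count P (take j w)
from P w j = count P (drop (j ∸ 1) w)

expo : Param → Word → ℕ → ℤ
expo pA w j = + upto isBC-BD-CD w j
expo pB w j = + (upto notAC-AD w j +ℕ from isCD w j)
expo pC w j = + (upto notAB-AD w j +ℕ from isBD w j)
expo pD w j = - (+ from isAB-AC-BC w j)

base : Param → Expr
base pA = var vA
base pB = var vB
base pC = var vC
base pD = var vA

paramAt : Param → Word → ℕ → Frac
paramAt X w j = embed (base X) *K qpow (expo X w j)

kernel : Frac → Frac → Frac → Frac
kernel t u v = (t /K (t -K u)) -K (t /K (t -K v))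

-- I_q(A;[u_1,v_1],…,[u_k,v_k];A): the single term t_1 = … = t_k = A
IqAA : List (Frac × Frac) → Frac
IqAA []              = oneK
IqAA ((u , v) ∷ ps)  = kernel (embed (var vA)) u v *K IqAA ps

intervals : Word → List (Frac × Frac)
intervals w = go 1 w
  where
  go : ℕ → Word → List (Frac × Frac)
  go j []       = []
  go j (l ∷ ls) = (paramAt (first l) w j , paramAt (second l) w j) ∷ go (suc j) ls

Lq : Word → Frac
Lq w = IqAA (intervals w)

-- With D = A every q-integral has the single term t₁ = ⋯ = t_k = A, so L_q(w) is the product over
-- the positions j of A (u − v) / ((A − u) (A − v)) with u, v the shifted parameters at j, and
-- position j of w corresponds to the mirrored position of τ(w), which carries τ(w_j). All
-- exponents at a position are determined by how many letters of a few kinds lie before and after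
-- it, and τ exchanges "before" and "after". Matching the numerator at each position of w with the
-- denominator at the mirrored position of τ(w), and vice versa, each matched pair factors into a
-- prefactor, a power of q, and linear factors A − B qⁿ, A − C qⁿ. The prefactors agree position
-- by position. Both total powers of q count the pairs i < j with w_i ∈ {BC, BD, CD} and
-- w_j ∈ {AB, AC, BC}. The exponents n of the linear factors agree as multisets by telescoping:
-- moving a letter across a gap lengthens some of the ranges 1..g, 1..x, 1..y, 1..z determined by
-- the letter counts around the gap, and the new range ends are exactly the exponents that the
-- letter contributes on the two sides.

module Submission where

open import Defs
open import Level using (0ℓ)
open import Data.Nat using (ℕ; zero; suc; _+_; _*_; _<_; _≡ᵇ_; s≤s; z≤n)
import Data.Nat.Properties as ℕ
open import Data.Nat.ListAction using (sum)
open import Data.Nat.Tactic.RingSolver using (solve-∀)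
open import Data.Integer as ℤ using (ℤ)
open import Data.Integer.Properties using () renaming (+-*-ring to ℤ-ring; _≟_ to _≟ℤ_)
open import Data.Bool using (Bool; true; false; T; if_then_else_)
open import Data.Empty using (⊥-elim)
open import Data.Maybe using (Maybe; just; nothing)
open import Data.Product using (_×_; _,_; proj₁; proj₂; ∃₂)
open import Data.List using (List; []; _∷_; _++_; [_]; reverse; map; length; take; drop; _ʳ++_; concatMap)
import Data.List.Properties as List
open import Function using (_∘_; id)
open import Relation.Nullary using (yes; no)
open import Relation.Binary.PropositionalEquality
  using (_≡_; refl; sym; trans; cong; cong₂; subst; module ≡-Reasoning)
open import Relation.Binary.Structures using (IsEquivalence)
import Relation.Binary.Reasoning.Setoid
open import Algebra.Bundles using (CommutativeRing; Ring)
open import Algebra.Structures using (IsCommutativeRing)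
import Algebra.Properties.CommutativeSemigroup
import Algebra.Solver.Ring
import Algebra.Solver.Ring.AlmostCommutativeRing as ACR

≋-isEquivalence : IsEquivalence _≋_
≋-isEquivalence = record { refl = ≋-refl ; sym = ≋-sym ; trans = ≋-trans }

⊕-identityʳ : ∀ x → x ⊕ con (ℤ.+ 0) ≋ x
⊕-identityʳ x = ≋-trans (⊕-comm x _) (⊕-idˡ x)

⊝-inverseʳ : ∀ x → x ⊕ (⊝ x) ≋ con (ℤ.+ 0)
⊝-inverseʳ x = ≋-trans (⊕-comm x _) (⊝-invˡ x)

⊗-identityʳ : ∀ x → x ⊗ con (ℤ.+ 1) ≋ x
⊗-identityʳ x = ≋-trans (⊗-comm x _) (⊗-idˡ x)

⊗-distribˡ : ∀ x y z → x ⊗ (y ⊕ z) ≋ (x ⊗ y) ⊕ (x ⊗ z)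
⊗-distribˡ x y z =
  ≋-trans (⊗-comm x _) (≋-trans (distribʳ x y z) (⊕-cong (⊗-comm y x) (⊗-comm z x)))

Expr-isCommutativeRing : IsCommutativeRing _≋_ _⊕_ _⊗_ ⊝_ (con (ℤ.+ 0)) (con (ℤ.+ 1))
Expr-isCommutativeRing = record
  { isRing = record
    { +-isAbelianGroup = record
      { isGroup = record
        { isMonoid = record
          { isSemigroup = record
            { isMagma = record { isEquivalence = ≋-isEquivalence ; ∙-cong = ⊕-cong }
            ; assoc = ⊕-assoc }
          ; identity = ⊕-idˡ , ⊕-identityʳ }
        ; inverse = ⊝-invˡ , ⊝-inverseʳ
        ; ⁻¹-cong = ⊝-cong }
      ; comm = ⊕-comm }
    ; *-cong = ⊗-cong
    ; *-assoc = ⊗-assoc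
    ; *-identity = ⊗-idˡ , ⊗-identityʳ
    ; distrib = ⊗-distribˡ , distribʳ }
  ; *-comm = ⊗-comm }

Expr-commutativeRing : CommutativeRing 0ℓ 0ℓ
Expr-commutativeRing = record { isCommutativeRing = Expr-isCommutativeRing }

con-morphism : Ring.rawRing ℤ-ring ACR.-Raw-AlmostCommutative⟶ ACR.fromCommutativeRing Expr-commutativeRing
con-morphism = record
  { ⟦_⟧ = con ; +-homo = con-+ ; *-homo = con-* ; -‿homo = con-neg
  ; 0-homo = ≋-refl ; 1-homo = ≋-refl }

con-≟ : (a b : ℤ) → Maybe (con a ≋ con b)
con-≟ a b with a ≟ℤ b
... | yes refl = just ≋-refl
... | no _     = nothing

open Algebra.Solver.Ring (Ring.rawRing ℤ-ring) (ACR.fromCommutativeRing Expr-commutativeRing) con-morphism con-≟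
  using (solve; _:=_; _:*_; _:-_; :-_; con; Polynomial)

module ≋-Reasoning = Relation.Binary.Reasoning.Setoid (CommutativeRing.setoid Expr-commutativeRing)
module ⊗ = Algebra.Properties.CommutativeSemigroup (CommutativeRing.*-commutativeSemigroup Expr-commutativeRing)
module +ℕ = Algebra.Properties.CommutativeSemigroup ℕ.+-commutativeSemigroup

≡⇒≋ : ∀ {x y} → x ≡ y → x ≋ y
≡⇒≋ refl = ≋-refl

c1 A B C q : Expr
c1 = con (ℤ.+ 1)
A  = var vA
B  = var vB
C  = var vC
q  = var vq

q^ : ℕ → Expr
q^ n = q ^^ n

q^-+ : ∀ m n → q^ (m + n) ≋ q^ m ⊗ q^ n
q^-+ zero    n = ≋-sym (⊗-idˡ (q^ n))
q^-+ (suc m) n = ≋-trans (⊗-cong ≋-refl (q^-+ m n)) (≋-sym (⊗-assoc q (q^ m) (q^ n)))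

prod : {X : Set} → (X → Expr) → List X → Expr
prod f []       = c1
prod f (x ∷ xs) = f x ⊗ prod f xs

prod-cong : {X : Set} {f g : X → Expr} → (∀ x → f x ≋ g x) → ∀ xs → prod f xs ≋ prod g xs
prod-cong f≋g []       = ≋-refl
prod-cong f≋g (x ∷ xs) = ⊗-cong (f≋g x) (prod-cong f≋g xs)

prod-map : {X Y : Set} (f : Y → Expr) (h : X → Y) (xs : List X) → prod f (map h xs) ≡ prod (f ∘ h) xs
prod-map f h []       = refl
prod-map f h (x ∷ xs) = cong (f (h x) ⊗_) (prod-map f h xs)

prod-++ : {X : Set} (f : X → Expr) (xs ys : List X) → prod f (xs ++ ys) ≋ prod f xs ⊗ prod f ys
prod-++ f []       ys = ≋-sym (⊗-idˡ _)
prod-++ f (x ∷ xs) ys = ≋-trans (⊗-cong ≋-refl (prod-++ f xs ys)) (≋-sym (⊗-assoc (f x) _ _))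

prod-reverse : {X : Set} (f : X → Expr) (xs : List X) → prod f (reverse xs) ≋ prod f xs
prod-reverse f []       = ≋-refl
prod-reverse f (x ∷ xs) = begin
  prod f (reverse (x ∷ xs))         ≡⟨ cong (prod f) (List.unfold-reverse x xs) ⟩
  prod f (reverse xs ++ [ x ])      ≈⟨ prod-++ f (reverse xs) [ x ] ⟩
  prod f (reverse xs) ⊗ (f x ⊗ c1)  ≈⟨ ⊗-cong (prod-reverse f xs) (⊗-identityʳ (f x)) ⟩
  prod f xs ⊗ f x                   ≈⟨ ⊗-comm _ _ ⟩
  f x ⊗ prod f xs                   ∎
  where open ≋-Reasoning

prod-⊗ : {X : Set} (f g : X → Expr) (xs : List X) → prod f xs ⊗ prod g xs ≋ prod (λ x → f x ⊗ g x) xs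
prod-⊗ f g []       = ⊗-idˡ c1
prod-⊗ f g (x ∷ xs) = ≋-trans (⊗.interchange _ _ _ _) (⊗-cong ≋-refl (prod-⊗ f g xs))

prod-middle : (f : ℕ → Expr) (x : ℕ) (ys zs : List ℕ) → prod f (ys ++ x ∷ zs) ≋ prod f (x ∷ ys ++ zs)
prod-middle f x []       zs = ≋-refl
prod-middle f x (y ∷ ys) zs = ≋-trans (⊗-cong ≋-refl (prod-middle f x ys zs)) (⊗.x∙yz≈y∙xz _ _ _)

hit : ℕ → ℕ → ℕ
hit v n = if v ≡ᵇ n then 1 else 0

mult : ℕ → List ℕ → ℕ
mult v []       = 0
mult v (n ∷ ns) = hit v n + mult v ns

≡ᵇ-refl : ∀ n → (n ≡ᵇ n) ≡ true
≡ᵇ-refl zero    = refl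
≡ᵇ-refl (suc n) = ≡ᵇ-refl n

mult-head : ∀ v ns → mult v (v ∷ ns) ≡ suc (mult v ns)
mult-head v ns rewrite ≡ᵇ-refl v = refl

mult-++ : ∀ v xs ys → mult v (xs ++ ys) ≡ mult v xs + mult v ys
mult-++ v []       ys = refl
mult-++ v (x ∷ xs) ys = trans (cong (hit v x +_) (mult-++ v xs ys)) (sym (ℕ.+-assoc (hit v x) (mult v xs) _))

mult-concatMap : {X : Set} (v : ℕ) (f : X → List ℕ) (xs : List X) →
                 mult v (concatMap f xs) ≡ sum (map (λ x → mult v (f x)) xs)
mult-concatMap v f []       = refl
mult-concatMap v f (x ∷ xs) =
  trans (mult-++ v (f x) (concatMap f xs)) (cong (mult v (f x) +_) (mult-concatMap v f xs))

mult-middle : ∀ v x ys zs → mult v (ys ++ x ∷ zs) ≡ mult v (x ∷ ys ++ zs)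
mult-middle v x []       zs = refl
mult-middle v x (y ∷ ys) zs =
  trans (cong (hit v y +_) (mult-middle v x ys zs)) (+ℕ.x∙yz≈y∙xz (hit v y) (hit v x) _)

occurrence : ∀ x ys → 0 < mult x ys → ∃₂ λ ys₁ ys₂ → ys ≡ ys₁ ++ x ∷ ys₂
occurrence x (y ∷ ys) occurs with x ≡ᵇ y in x≡ᵇy
... | true  rewrite ℕ.≡ᵇ⇒≡ x y (subst T (sym x≡ᵇy) _) = [] , ys , refl
... | false with occurrence x ys occurs
...   | ys₁ , ys₂ , refl = y ∷ ys₁ , ys₂ , refl

prod-mult : (f : ℕ → Expr) (xs ys : List ℕ) → (∀ v → mult v xs ≡ mult v ys) → prod f xs ≋ prod f ys
prod-mult f []       []       _    = ≋-refl
prod-mult f []       (y ∷ ys) same = ⊥-elim (ℕ.0≢1+n (trans (same y) (mult-head y ys)))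
prod-mult f (x ∷ xs) ys       same
  with occurrence x ys (subst (0 <_) (trans (sym (mult-head x xs)) (same x)) (s≤s z≤n))
... | ys₁ , ys₂ , refl =
  ≋-trans (⊗-cong ≋-refl (prod-mult f xs (ys₁ ++ ys₂) same′)) (≋-sym (prod-middle f x ys₁ ys₂))
  where
  same′ : ∀ v → mult v xs ≡ mult v (ys₁ ++ ys₂)
  same′ v = ℕ.+-cancelˡ-≡ _ _ _ (trans (same v) (mult-middle v x ys₁ ys₂))

letterwise : {X : Set} {f h : Letter → X} →
  (f eAB , f eAC , f eAD , f eBC , f eBD , f eCD) ≡ (h eAB , h eAC , h eAD , h eBC , h eBD , h eCD) →
  ∀ l → f l ≡ h l
letterwise same eAB = cong proj₁ same
letterwise same eAC = cong (proj₁ ∘ proj₂) same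
letterwise same eAD = cong (proj₁ ∘ proj₂ ∘ proj₂) same
letterwise same eBC = cong (proj₁ ∘ proj₂ ∘ proj₂ ∘ proj₂) same
letterwise same eBD = cong (proj₁ ∘ proj₂ ∘ proj₂ ∘ proj₂ ∘ proj₂) same
letterwise same eCD = cong (proj₂ ∘ proj₂ ∘ proj₂ ∘ proj₂ ∘ proj₂) same

τL-involutive : ∀ l → τL (τL l) ≡ l
τL-involutive = letterwise refl

isAB isAC notBD-AD notCD-AD : Letter → Bool
isAB eAB = true
isAB _   = false
isAC eAC = true
isAC _   = false
notBD-AD eBD = false
notBD-AD eAD = false
notBD-AD _   = true
notCD-AD eCD = false
notCD-AD eAD = false
notCD-AD _   = true

ind : Bool → ℕ
ind b = if b then 1 else 0

count-∷ : ∀ P l xs → count P (l ∷ xs) ≡ ind (P l) + count P xs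
count-∷ P l xs with P l
... | true  = refl
... | false = refl

count-++ : ∀ P xs ys → count P (xs ++ ys) ≡ count P xs + count P ys
count-++ P []       ys = refl
count-++ P (x ∷ xs) ys = begin
  count P (x ∷ xs ++ ys)                 ≡⟨ count-∷ P x (xs ++ ys) ⟩
  ind (P x) + count P (xs ++ ys)         ≡⟨ cong (ind (P x) +_) (count-++ P xs ys) ⟩
  ind (P x) + (count P xs + count P ys)  ≡⟨ ℕ.+-assoc (ind (P x)) _ _ ⟨
  (ind (P x) + count P xs) + count P ys  ≡⟨ cong (_+ count P ys) (count-∷ P x xs) ⟨
  count P (x ∷ xs) + count P ys          ∎
  where open ≡-Reasoning

count-reverse : ∀ P xs → count P (reverse xs) ≡ count P xs
count-reverse P []       = refl
count-reverse P (x ∷ xs) = begin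
  count P (reverse (x ∷ xs))            ≡⟨ cong (count P) (List.unfold-reverse x xs) ⟩
  count P (reverse xs ++ [ x ])         ≡⟨ count-++ P (reverse xs) [ x ] ⟩
  count P (reverse xs) + count P [ x ]  ≡⟨ cong (_+ count P [ x ]) (count-reverse P xs) ⟩
  count P xs + count P [ x ]            ≡⟨ ℕ.+-comm (count P xs) _ ⟩
  count P [ x ] + count P xs            ≡⟨ count-++ P [ x ] xs ⟨
  count P (x ∷ xs)                      ∎
  where open ≡-Reasoning

count-split : ∀ {P Q R} → (∀ l → ind (P l) ≡ ind (Q l) + ind (R l)) →
              ∀ xs → count P xs ≡ count Q xs + count R xs
count-split split [] = refl
count-split {P} {Q} {R} split (x ∷ xs) = begin
  count P (x ∷ xs)                                     ≡⟨ count-∷ P x xs ⟩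
  ind (P x) + count P xs                               ≡⟨ cong₂ _+_ (split x) (count-split split xs) ⟩
  (ind (Q x) + ind (R x)) + (count Q xs + count R xs)  ≡⟨ +ℕ.interchange (ind (Q x)) _ _ _ ⟩
  (ind (Q x) + count Q xs) + (ind (R x) + count R xs)  ≡⟨ cong₂ _+_ (count-∷ Q x xs) (count-∷ R x xs) ⟨
  count Q (x ∷ xs) + count R (x ∷ xs)                  ∎
  where open ≡-Reasoning

count-map : ∀ {P Q} f → (∀ l → P (f l) ≡ Q l) → ∀ xs → count P (map f xs) ≡ count Q xs
count-map f P∘f≗Q [] = refl
count-map {P} {Q} f P∘f≗Q (x ∷ xs) = begin
  count P (f x ∷ map f xs)            ≡⟨ count-∷ P (f x) (map f xs) ⟩
  ind (P (f x)) + count P (map f xs)  ≡⟨ cong₂ _+_ (cong ind (P∘f≗Q x)) (count-map f P∘f≗Q xs) ⟩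
  ind (Q x) + count Q xs              ≡⟨ count-∷ Q x xs ⟨
  count Q (x ∷ xs)                    ∎
  where open ≡-Reasoning

-- `before` lists the letters preceding the focus, nearest first.
infix 4 _◂_▸_
record Zipper : Set where
  constructor _◂_▸_
  field
    before : Word
    focus  : Letter
    after  : Word
open Zipper

zippers : Word → Word → List Zipper
zippers rp []      = []
zippers rp (l ∷ s) = (rp ◂ l ▸ s) ∷ zippers (l ∷ rp) s

τᶻ : Zipper → Zipper
τᶻ (rp ◂ l ▸ s) = map τL s ◂ τL l ▸ map τL rp

extendBefore extendAfter : Letter → Zipper → Zipper
extendBefore x (rp ◂ l ▸ s) = rp ++ [ x ] ◂ l ▸ s
extendAfter  x (rp ◂ l ▸ s) = rp ◂ l ▸ s ++ [ x ]

zippers-extendBefore : ∀ x rp s → zippers (rp ++ [ x ]) s ≡ map (extendBefore x) (zippers rp s)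
zippers-extendBefore x rp []      = refl
zippers-extendBefore x rp (l ∷ s) = cong ((rp ++ [ x ] ◂ l ▸ s) ∷_) (zippers-extendBefore x (l ∷ rp) s)

zippers-∷ʳ : ∀ rp s x → zippers rp (s ++ [ x ]) ≡ map (extendAfter x) (zippers rp s) ++ [ s ʳ++ rp ◂ x ▸ [] ]
zippers-∷ʳ rp []      x = refl
zippers-∷ʳ rp (l ∷ s) x = cong ((rp ◂ l ▸ s ++ [ x ]) ∷_) (zippers-∷ʳ (l ∷ rp) s x)

τᶻ-extendBefore : ∀ x z → τᶻ (extendBefore x z) ≡ extendAfter (τL x) (τᶻ z)
τᶻ-extendBefore x (rp ◂ l ▸ s) = cong (map τL s ◂ τL l ▸_) (List.map-++ τL rp [ x ])

map-τᶻ-zippers : ∀ l w → map (extendAfter (τL l)) (map τᶻ (zippers [] w)) ≡ map τᶻ (zippers [ l ] w)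
map-τᶻ-zippers l w = begin
  map (extendAfter (τL l)) (map τᶻ (zippers [] w))  ≡⟨ List.map-∘ (zippers [] w) ⟨
  map (extendAfter (τL l) ∘ τᶻ) (zippers [] w)      ≡⟨ List.map-cong (sym ∘ τᶻ-extendBefore l) (zippers [] w) ⟩
  map (τᶻ ∘ extendBefore l) (zippers [] w)          ≡⟨ List.map-∘ (zippers [] w) ⟩
  map τᶻ (map (extendBefore l) (zippers [] w))      ≡⟨ cong (map τᶻ) (zippers-extendBefore l [] w) ⟨
  map τᶻ (zippers [ l ] w)                          ∎
  where open ≡-Reasoning

zippers-τ : ∀ w → zippers [] (τ w) ≡ reverse (map τᶻ (zippers [] w))
zippers-τ []      = refl
zippers-τ (l ∷ w) = begin
  zippers [] (τ (l ∷ w))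
    ≡⟨ cong (zippers []) (List.unfold-reverse (τL l) (map τL w)) ⟩
  zippers [] (τ w ++ [ τL l ])
    ≡⟨ zippers-∷ʳ [] (τ w) (τL l) ⟩
  map (extendAfter (τL l)) (zippers [] (τ w)) ++ [ reverse (τ w) ◂ τL l ▸ [] ]
    ≡⟨ cong₂ (λ zs rw → map (extendAfter (τL l)) zs ++ [ rw ◂ τL l ▸ [] ])
             (zippers-τ w) (List.reverse-involutive (map τL w)) ⟩
  map (extendAfter (τL l)) (reverse (map τᶻ (zippers [] w))) ++ [ last ]
    ≡⟨ cong (_++ [ last ]) (List.reverse-map (extendAfter (τL l)) (map τᶻ (zippers [] w))) ⟩
  reverse (map (extendAfter (τL l)) (map τᶻ (zippers [] w))) ++ [ last ]
    ≡⟨ cong (λ zs → reverse zs ++ [ last ]) (map-τᶻ-zippers l w) ⟩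
  reverse (map τᶻ (zippers [ l ] w)) ++ [ last ]
    ≡⟨ List.unfold-reverse last (map τᶻ (zippers [ l ] w)) ⟨
  reverse (map τᶻ (zippers [] (l ∷ w)))
    ∎
  where
  open ≡-Reasoning
  last : Zipper
  last = τᶻ ([] ◂ l ▸ w)

-- L_q as a product over zippers

-- `intervals` recurses through a helper local to its where-block; the unification problem posed
-- by `intervals-unfold` solves the meta `intervalsFrom` to that helper.
mutual
  intervalsFrom : Word → ℕ → Word → List (Frac × Frac)
  intervalsFrom = _

  private
    intervals-unfold : ∀ l ls → intervals (l ∷ ls) ≡
      (paramAt (first l) (l ∷ ls) 1 , paramAt (second l) (l ∷ ls) 1) ∷ intervalsFrom (l ∷ ls) 2 ls
    intervals-unfold l ls with l ∷ ls | 2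
    ... | w | j = refl

interval : Zipper → Frac × Frac
interval (rp ◂ l ▸ s) = paramAt (first l) w j , paramAt (second l) w j
  where
  w : Word
  w = rp ʳ++ (l ∷ s)
  j : ℕ
  j = suc (length rp)

intervalsFrom-zippers : ∀ rp s → intervalsFrom (rp ʳ++ s) (suc (length rp)) s ≡ map interval (zippers rp s)
intervalsFrom-zippers rp []      = refl
intervalsFrom-zippers rp (l ∷ s) = cong (interval (rp ◂ l ▸ s) ∷_) (intervalsFrom-zippers (l ∷ rp) s)

intervals-zippers : ∀ w → intervals w ≡ map interval (zippers [] w)
intervals-zippers = intervalsFrom-zippers []

kn kd : Frac × Frac → Expr
kn (u , v) = num (kernel (embed A) u v)
kd (u , v) = den (kernel (embed A) u v)

num-IqAA : ∀ ps → num (IqAA ps) ≡ prod kn ps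
num-IqAA []       = refl
num-IqAA (p ∷ ps) = cong (kn p ⊗_) (num-IqAA ps)

den-IqAA : ∀ ps → den (IqAA ps) ≡ prod kd ps
den-IqAA []       = refl
den-IqAA (p ∷ ps) = cong (kd p ⊗_) (den-IqAA ps)

prod-intervals : ∀ f w → prod f (intervals w) ≡ prod (f ∘ interval) (zippers [] w)
prod-intervals f w = trans (cong (prod f) (intervals-zippers w)) (prod-map f interval (zippers [] w))

prod-intervals-τ : ∀ f w → prod f (intervals (τ w)) ≋ prod (f ∘ interval ∘ τᶻ) (zippers [] w)
prod-intervals-τ f w = begin
  prod f (intervals (τ w))                               ≡⟨ prod-intervals f (τ w) ⟩
  prod (f ∘ interval) (zippers [] (τ w))                 ≡⟨ cong (prod (f ∘ interval)) (zippers-τ w) ⟩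
  prod (f ∘ interval) (reverse (map τᶻ (zippers [] w)))  ≈⟨ prod-reverse (f ∘ interval) _ ⟩
  prod (f ∘ interval) (map τᶻ (zippers [] w))            ≡⟨ prod-map (f ∘ interval) τᶻ (zippers [] w) ⟩
  prod (f ∘ interval ∘ τᶻ) (zippers [] w)                ∎
  where open ≋-Reasoning

take-suc-length : {X : Set} (xs : List X) (y : X) (ys : List X) →
                  take (suc (length xs)) (xs ++ y ∷ ys) ≡ xs ++ [ y ]
take-suc-length []       y ys = refl
take-suc-length (x ∷ xs) y ys = cong (x ∷_) (take-suc-length xs y ys)

drop-length : {X : Set} (xs ys : List X) → drop (length xs) (xs ++ ys) ≡ ys
drop-length []       ys = refl
drop-length (x ∷ xs) ys = drop-length xs ys

upto-zipper : ∀ P rp l s → upto P (rp ʳ++ l ∷ s) (suc (length rp)) ≡ count P (l ∷ rp)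
upto-zipper P rp l s = begin
  count P (take (suc (length rp)) (rp ʳ++ l ∷ s))
    ≡⟨ cong₂ (λ n xs → count P (take (suc n) xs)) (sym (List.length-reverse rp)) (List.ʳ++-defn rp) ⟩
  count P (take (suc (length (reverse rp))) (reverse rp ++ l ∷ s))
    ≡⟨ cong (count P) (take-suc-length (reverse rp) l s) ⟩
  count P (reverse rp ++ [ l ])
    ≡⟨ cong (count P) (List.unfold-reverse l rp) ⟨
  count P (reverse (l ∷ rp))
    ≡⟨ count-reverse P (l ∷ rp) ⟩
  count P (l ∷ rp)
    ∎
  where open ≡-Reasoning

from-zipper : ∀ P rp l s → from P (rp ʳ++ l ∷ s) (suc (length rp)) ≡ count P (l ∷ s)
from-zipper P rp l s = begin
  count P (drop (length rp) (rp ʳ++ l ∷ s))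
    ≡⟨ cong₂ (λ n xs → count P (drop n xs)) (sym (List.length-reverse rp)) (List.ʳ++-defn rp) ⟩
  count P (drop (length (reverse rp)) (reverse rp ++ l ∷ s))
    ≡⟨ cong (count P) (drop-length (reverse rp) (l ∷ s)) ⟩
  count P (l ∷ s)
    ∎
  where open ≡-Reasoning

expoAt : Param → Word → Letter → Word → ℤ
expoAt pA rp l s = ℤ.+ count isBC-BD-CD (l ∷ rp)
expoAt pB rp l s = ℤ.+ (count notAC-AD (l ∷ rp) + count isCD (l ∷ s))
expoAt pC rp l s = ℤ.+ (count notAB-AD (l ∷ rp) + count isBD (l ∷ s))
expoAt pD rp l s = ℤ.- (ℤ.+ count isAB-AC-BC (l ∷ s))

expo-zipper : ∀ X rp l s → expo X (rp ʳ++ l ∷ s) (suc (length rp)) ≡ expoAt X rp l s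
expo-zipper pA rp l s = cong ℤ.+_ (upto-zipper isBC-BD-CD rp l s)
expo-zipper pB rp l s = cong ℤ.+_ (cong₂ _+_ (upto-zipper notAC-AD rp l s) (from-zipper isCD rp l s))
expo-zipper pC rp l s = cong ℤ.+_ (cong₂ _+_ (upto-zipper notAB-AD rp l s) (from-zipper isBD rp l s))
expo-zipper pD rp l s = cong (λ n → ℤ.- (ℤ.+ n)) (from-zipper isAB-AC-BC rp l s)

record PairStats : Set where
  constructor ⟨_,_,_,_⟩
  field
    g x y z : ℕ
open PairStats

record Stats : Set where
  constructor stats
  field
    α δ           : ℕ
    statsB statsC : PairStats
open Stats

pairStats : (P Q P′ Q′ : Letter → Bool) → Word → Word → PairStats
pairStats P Q P′ Q′ rp s =
  ⟨ count P rp + count Q s , count P′ rp + count Q s , count P rp + count Q′ s , count P′ rp + count Q′ s ⟩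

gapStats : Word → Word → Stats
gapStats rp s = stats (count isBC-BD-CD rp) (count isAB-AC-BC s)
  (pairStats isAB isCD notAC-AD notBD-AD rp s)
  (pairStats isAC isBD notAB-AD notCD-AD rp s)

statsAt : Zipper → Stats
statsAt (rp ◂ l ▸ s) = gapStats rp s

mirrorᵖ : PairStats → PairStats
mirrorᵖ ⟨ g , x , y , z ⟩ = ⟨ g , y , x , z ⟩

mirror : Stats → Stats
mirror (stats a d b c) = stats d a (mirrorᵖ b) (mirrorᵖ c)

record Consistentᵖ (a d : ℕ) (p : PairStats) : Set where
  field
    x≡α+g : x p ≡ a + g p
    y≡δ+g : y p ≡ d + g p
    z≡x+δ : z p ≡ x p + d
    z≡y+α : z p ≡ y p + a
open Consistentᵖ

Consistent : Stats → Set
Consistent st = Consistentᵖ (α st) (δ st) (statsB st) × Consistentᵖ (α st) (δ st) (statsC st)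

mirror-consistent : ∀ {st} → Consistent st → Consistent (mirror st)
mirror-consistent (cB , cC) = swap cB , swap cC
  where
  swap : ∀ {a d p} → Consistentᵖ a d p → Consistentᵖ d a (mirrorᵖ p)
  swap c = record { x≡α+g = y≡δ+g c ; y≡δ+g = x≡α+g c ; z≡x+δ = z≡y+α c ; z≡y+α = z≡x+δ c }

pairStats-consistent : ∀ {P Q P′ Q′} →
  (∀ l → ind (P′ l) ≡ ind (isBC-BD-CD l) + ind (P l)) → (∀ l → ind (Q′ l) ≡ ind (isAB-AC-BC l) + ind (Q l)) →
  ∀ rp s → Consistentᵖ (count isBC-BD-CD rp) (count isAB-AC-BC s) (pairStats P Q P′ Q′ rp s)
pairStats-consistent {P} {Q} {P′} {Q′} P′-split Q′-split rp s
  rewrite count-split {P′} {isBC-BD-CD} {P} P′-split rp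
        | count-split {Q′} {isAB-AC-BC} {Q} Q′-split s = record
  { x≡α+g = ℕ.+-assoc #α #P #Q
  ; y≡δ+g = +ℕ.x∙yz≈y∙xz #P #δ #Q
  ; z≡x+δ = z≡x+δ′ #α #P #δ #Q
  ; z≡y+α = z≡y+α′ #α #P #δ #Q
  }
  where
  #α #P #δ #Q : ℕ
  #α = count isBC-BD-CD rp
  #P = count P rp
  #δ = count isAB-AC-BC s
  #Q = count Q s
  z≡x+δ′ : ∀ a p d q → (a + p) + (d + q) ≡ ((a + p) + q) + d
  z≡x+δ′ = solve-∀
  z≡y+α′ : ∀ a p d q → (a + p) + (d + q) ≡ (p + (d + q)) + a
  z≡y+α′ = solve-∀

gapStats-consistent : ∀ rp s → Consistent (gapStats rp s)
gapStats-consistent rp s =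
  pairStats-consistent (letterwise refl) (letterwise refl) rp s ,
  pairStats-consistent (letterwise refl) (letterwise refl) rp s

pairStats-τ : ∀ {P Q P′ Q′} → (∀ l → P (τL l) ≡ Q l) → (∀ l → Q (τL l) ≡ P l) →
  (∀ l → P′ (τL l) ≡ Q′ l) → (∀ l → Q′ (τL l) ≡ P′ l) →
  ∀ rp s → pairStats P Q P′ Q′ (map τL s) (map τL rp) ≡ mirrorᵖ (pairStats P Q P′ Q′ rp s)
pairStats-τ P∘τ Q∘τ P′∘τ Q′∘τ rp s =
  ⟨⟩-cong (swap P∘τ Q∘τ) (swap P′∘τ Q∘τ) (swap P∘τ Q′∘τ) (swap P′∘τ Q′∘τ)
  where
  ⟨⟩-cong : ∀ {g x y z g′ x′ y′ z′} → g ≡ g′ → x ≡ x′ → y ≡ y′ → z ≡ z′ →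
            ⟨ g , x , y , z ⟩ ≡ ⟨ g′ , x′ , y′ , z′ ⟩
  ⟨⟩-cong refl refl refl refl = refl
  swap : ∀ {R R′ S S′} → (∀ l → R (τL l) ≡ R′ l) → (∀ l → S (τL l) ≡ S′ l) →
         count R (map τL s) + count S (map τL rp) ≡ count S′ rp + count R′ s
  swap {R′ = R′} {S′ = S′} R∘τ S∘τ =
    trans (cong₂ _+_ (count-map τL R∘τ s) (count-map τL S∘τ rp)) (ℕ.+-comm (count R′ s) (count S′ rp))

gapStats-τ : ∀ rp s → gapStats (map τL s) (map τL rp) ≡ mirror (gapStats rp s)
gapStats-τ rp s = stats-cong
  (count-map τL (letterwise refl) s) (count-map τL (letterwise refl) rp)
  (pairStats-τ (letterwise refl) (letterwise refl) (letterwise refl) (letterwise refl) rp s)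
  (pairStats-τ (letterwise refl) (letterwise refl) (letterwise refl) (letterwise refl) rp s)
  where
  stats-cong : ∀ {a d b c a′ d′ b′ c′} → a ≡ a′ → d ≡ d′ → b ≡ b′ → c ≡ c′ → stats a d b c ≡ stats a′ d′ b′ c′
  stats-cong refl refl refl refl = refl

infix 8 _·q^_ _·q^-_
_·q^_ _·q^-_ : Expr → ℕ → Frac
X ·q^ n  = embed X *K (q^ n // c1)
X ·q^- n = embed X *K (c1 // q^ n)

intervalAt : Letter → Stats → Frac × Frac
intervalAt eAB st = A ·q^ α st , B ·q^ suc (x (statsB st))
intervalAt eAC st = A ·q^ α st , C ·q^ suc (x (statsC st))
intervalAt eAD st = A ·q^ α st , A ·q^- δ st
intervalAt eBC st = B ·q^ suc (x (statsB st)) , C ·q^ suc (x (statsC st))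
intervalAt eBD st = B ·q^ suc (x (statsB st)) , A ·q^- δ st
intervalAt eCD st = C ·q^ suc (x (statsC st)) , A ·q^- δ st

qpow-neg : ∀ n → qpow (ℤ.- (ℤ.+ n)) ≡ c1 // q^ n
qpow-neg zero    = refl
qpow-neg (suc n) = refl

interval-zipper : ∀ rp l s → interval (rp ◂ l ▸ s) ≡ intervalAt l (gapStats rp s)
interval-zipper rp l s =
  trans (cong₂ _,_ (cong (param (first l)) (expo-zipper (first l) rp l s))
                   (cong (param (second l)) (expo-zipper (second l) rp l s)))
        (by-letter l)
  where
  param : Param → ℤ → Frac
  param X e = embed (base X) *K qpow e
  negative-δ : param pD (ℤ.- (ℤ.+ count isAB-AC-BC s)) ≡ A ·q^- count isAB-AC-BC s
  negative-δ = cong (embed A *K_) (qpow-neg (count isAB-AC-BC s))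
  by-letter : ∀ l → (param (first l) (expoAt (first l) rp l s) , param (second l) (expoAt (second l) rp l s))
                    ≡ intervalAt l (gapStats rp s)
  by-letter eAB = refl
  by-letter eAC = refl
  by-letter eAD = cong₂ _,_ refl negative-δ
  by-letter eBC = refl
  by-letter eBD = cong₂ _,_ refl negative-δ
  by-letter eCD = cong₂ _,_ refl negative-δ

interval-τᶻ : ∀ rp l s → interval (τᶻ (rp ◂ l ▸ s)) ≡ intervalAt (τL l) (mirror (gapStats rp s))
interval-τᶻ rp l s =
  trans (interval-zipper (map τL s) (τL l) (map τL rp)) (cong (intervalAt (τL l)) (gapStats-τ rp s))

-- Factorisation of a matched pair of kernels

infix 4 _≈ᶠ_
_≈ᶠ_ : Frac → Frac → Set
u ≈ᶠ v = num u ≋ num v × den u ≋ den v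

≈ᶠ-refl : ∀ {u} → u ≈ᶠ u
≈ᶠ-refl = ≋-refl , ≋-refl

-K-cong : ∀ {a a′ b b′} → a ≈ᶠ a′ → b ≈ᶠ b′ → (a -K b) ≈ᶠ (a′ -K b′)
-K-cong (na , da) (nb , db) = ⊕-cong (⊗-cong na db) (⊝-cong (⊗-cong nb da)) , ⊗-cong da db

/K-cong : ∀ {a a′ b b′} → a ≈ᶠ a′ → b ≈ᶠ b′ → (a /K b) ≈ᶠ (a′ /K b′)
/K-cong (na , da) (nb , db) = ⊗-cong na db , ⊗-cong da nb

kernel-cong : ∀ t {u u′ v v′} → u ≈ᶠ u′ → v ≈ᶠ v′ → kernel t u v ≈ᶠ kernel t u′ v′
kernel-cong t u≈ v≈ = -K-cong (/K-cong ≈ᶠ-refl (-K-cong ≈ᶠ-refl u≈)) (/K-cong ≈ᶠ-refl (-K-cong ≈ᶠ-refl v≈))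

kn-cong : ∀ {u u′ v v′} → u ≈ᶠ u′ → v ≈ᶠ v′ → kn (u , v) ≋ kn (u′ , v′)
kn-cong u≈ v≈ = proj₁ (kernel-cong (embed A) u≈ v≈)

·q^-suc-+ : ∀ X m n → X ·q^ suc (m + n) ≈ᶠ (X ⊗ (q ⊗ (q^ m ⊗ q^ n))) // (c1 ⊗ c1)
·q^-suc-+ X m n = ⊗-cong ≋-refl (⊗-cong ≋-refl (q^-+ m n)) , ≋-refl

atom-suc-+ : ∀ X m n → A ⊖ (X ⊗ q^ (suc (m + n))) ≋ A ⊖ (X ⊗ (q ⊗ (q^ m ⊗ q^ n)))
atom-suc-+ X m n = ⊕-cong ≋-refl (⊝-cong (⊗-cong ≋-refl (⊗-cong ≋-refl (q^-+ m n))))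

σ : Letter → Letter
σ eAB = eAC
σ eAC = eAB
σ eAD = eAD
σ eBC = eBC
σ eBD = eCD
σ eCD = eBD

atomB atomC : ℕ → Expr
atomB n = A ⊖ (B ⊗ q^ n)
atomC n = A ⊖ (C ⊗ q^ n)

atoms : Letter → PairStats → List ℕ
atoms eAB p = [ suc (g p) ]
atoms eAC p = [ suc (y p) ]
atoms eAD p = []
atoms eBC p = [ suc (y p) ]
atoms eBD p = [ suc (z p) ]
atoms eCD p = [ suc (y p) ]

−A² : Expr
−A² = ⊝ (A ⊗ A)

prefactor : Letter → Stats → Expr
prefactor eAB st = −A² ⊗ (c1 ⊖ q^ (α st))
prefactor eAC st = −A² ⊗ (c1 ⊖ q^ (α st))
prefactor eAD st = ((A ⊗ A) ⊗ (A ⊗ A)) ⊗ ((c1 ⊖ (q^ (α st) ⊗ q^ (δ st))) ⊗ ((c1 ⊖ q^ (α st)) ⊗ (c1 ⊖ q^ (δ st))))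
prefactor eBC st = A ⊗ ((B ⊗ q^ (suc (g (statsB st)))) ⊖ (C ⊗ q^ (suc (g (statsC st)))))
prefactor eBD st = −A² ⊗ (c1 ⊖ q^ (δ st))
prefactor eCD st = −A² ⊗ (c1 ⊖ q^ (δ st))

qExponent : Letter → Stats → ℕ
qExponent eAB st = α st
qExponent eAC st = α st
qExponent eAD st = 0
qExponent eBC st = α st
qExponent eBD st = 0
qExponent eCD st = 0

atomForm : Expr → ℕ → List ℕ → List ℕ → Expr
atomForm u e bs cs = u ⊗ (q^ e ⊗ (prod atomB bs ⊗ prod atomC cs))

factored : Letter → Stats → Expr
factored l st = atomForm (prefactor l st) (qExponent l st) (atoms l (statsB st)) (atoms (σ l) (statsC st))

atomForm-⊗ : ∀ u e bs cs u′ e′ bs′ cs′ →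
  atomForm u e bs cs ⊗ atomForm u′ e′ bs′ cs′ ≋ atomForm (u ⊗ u′) (e + e′) (bs ++ bs′) (cs ++ cs′)
atomForm-⊗ u e bs cs u′ e′ bs′ cs′ =
  ≋-trans (⊗.interchange u _ u′ _) (⊗-cong ≋-refl
  (≋-trans (⊗.interchange (q^ e) _ (q^ e′) _) (⊗-cong (≋-sym (q^-+ e e′))
  (≋-trans (⊗.interchange (prod atomB bs) _ (prod atomB bs′) _)
           (⊗-cong (≋-sym (prod-++ atomB bs bs′)) (≋-sym (prod-++ atomC cs cs′)))))))

prod-atomForm : {X : Set} (u : X → Expr) (e : X → ℕ) (bs cs : X → List ℕ) (xs : List X) →
  prod (λ a → atomForm (u a) (e a) (bs a) (cs a)) xs
  ≋ atomForm (prod u xs) (sum (map e xs)) (concatMap bs xs) (concatMap cs xs)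
prod-atomForm u e bs cs []       = ≋-sym (≋-trans (⊗-cong ≋-refl (≋-trans (⊗-idˡ _) (⊗-idˡ c1))) (⊗-idˡ c1))
prod-atomForm u e bs cs (a ∷ xs) =
  ≋-trans (⊗-cong ≋-refl (prod-atomForm u e bs cs xs)) (atomForm-⊗ (u a) (e a) (bs a) (cs a) _ _ _ _)

atomForm-cong : ∀ {u u′ e e′ bs bs′ cs cs′} → u ≋ u′ → e ≡ e′ →
  (∀ v → mult v bs ≡ mult v bs′) → (∀ v → mult v cs ≡ mult v cs′) →
  atomForm u e bs cs ≋ atomForm u′ e′ bs′ cs′
atomForm-cong {bs = bs} {bs′} {cs} {cs′} u≋ refl bs≈ cs≈ =
  ⊗-cong u≋ (⊗-cong ≋-refl (⊗-cong (prod-mult atomB bs bs′ bs≈) (prod-mult atomC cs cs′ cs≈)))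

-- Solver polynomials whose semantics unfolds exactly to kn, kd, _·q^_, _·q^-_ and the atoms.
private
  module _ {n : ℕ} where
    1ₚ : Polynomial n
    1ₚ = con (ℤ.+ 1)

    infix 8 _·qₚ_ _·qₚ⁻_
    _·qₚ_ _·qₚ⁻_ : Polynomial n → Polynomial n → Polynomial n × Polynomial n
    X ·qₚ Q  = X :* Q , 1ₚ :* 1ₚ
    X ·qₚ⁻ Q = X :* 1ₚ , 1ₚ :* Q

    Δₚ : Polynomial n → Polynomial n × Polynomial n → Polynomial n
    Δₚ A (uN , uD) = (A :* uD) :- (uN :* 1ₚ)

    knₚ kdₚ : Polynomial n → (u v : Polynomial n × Polynomial n) → Polynomial n
    knₚ A u v = ((A :* (1ₚ :* proj₂ u)) :* (1ₚ :* Δₚ A v)) :- ((A :* (1ₚ :* proj₂ v)) :* (1ₚ :* Δₚ A u))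
    kdₚ A u v = (1ₚ :* Δₚ A u) :* (1ₚ :* Δₚ A v)

    atomₚ : Polynomial n → Polynomial n → Polynomial n → Polynomial n
    atomₚ A X Q = (A :- (X :* Q)) :* 1ₚ

    −A²ₚ : Polynomial n → Polynomial n
    −A²ₚ A = :- (A :* A)

factorise : ∀ l st → Consistent st →
            kn (intervalAt l st) ⊗ kd (intervalAt (τL l) (mirror st)) ≋ factored l st
factorise eAB st (cB , _) rewrite x≡α+g cB =
  ≋-trans (⊗-cong (kn-cong ≈ᶠ-refl (·q^-suc-+ B (α st) (g (statsB st)))) ≋-refl)
    (solve 7 (λ A B C q Qα Qg Qy →
       knₚ A (A ·qₚ Qα) (B ·qₚ (q :* (Qα :* Qg))) :* kdₚ A (C ·qₚ (q :* Qy)) (A ·qₚ⁻ Qα)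
       := (−A²ₚ A :* (1ₚ :- Qα)) :* (Qα :* (atomₚ A B (q :* Qg) :* atomₚ A C (q :* Qy))))
     ≋-refl A B C q (q^ (α st)) (q^ (g (statsB st))) (q^ (y (statsC st))))
factorise eAC st (_ , cC) rewrite x≡α+g cC =
  ≋-trans (⊗-cong (kn-cong ≈ᶠ-refl (·q^-suc-+ C (α st) (g (statsC st)))) ≋-refl)
    (solve 7 (λ A B C q Qα Qg Qy →
       knₚ A (A ·qₚ Qα) (C ·qₚ (q :* (Qα :* Qg))) :* kdₚ A (B ·qₚ (q :* Qy)) (A ·qₚ⁻ Qα)
       := (−A²ₚ A :* (1ₚ :- Qα)) :* (Qα :* (atomₚ A B (q :* Qy) :* atomₚ A C (q :* Qg))))
     ≋-refl A B C q (q^ (α st)) (q^ (g (statsC st))) (q^ (y (statsB st))))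
factorise eAD st _ =
  solve 3 (λ A Qα Qδ →
    knₚ A (A ·qₚ Qα) (A ·qₚ⁻ Qδ) :* kdₚ A (A ·qₚ Qδ) (A ·qₚ⁻ Qα)
    := ((A :* A) :* (A :* A)) :* ((1ₚ :- (Qα :* Qδ)) :* ((1ₚ :- Qα) :* (1ₚ :- Qδ)))
       :* (1ₚ :* (1ₚ :* 1ₚ)))
  ≋-refl A (q^ (α st)) (q^ (δ st))
factorise eBC st (cB , cC) rewrite x≡α+g cB | x≡α+g cC =
  ≋-trans (⊗-cong (kn-cong (·q^-suc-+ B (α st) (g (statsB st))) (·q^-suc-+ C (α st) (g (statsC st)))) ≋-refl)
    (solve 9 (λ A B C q Qα Qgb Qgc Qyb Qyc →
       knₚ A (B ·qₚ (q :* (Qα :* Qgb))) (C ·qₚ (q :* (Qα :* Qgc)))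
         :* kdₚ A (B ·qₚ (q :* Qyb)) (C ·qₚ (q :* Qyc))
       := (A :* ((B :* (q :* Qgb)) :- (C :* (q :* Qgc))))
         :* (Qα :* (atomₚ A B (q :* Qyb) :* atomₚ A C (q :* Qyc))))
     ≋-refl A B C q (q^ (α st)) (q^ (g (statsB st))) (q^ (g (statsC st)))
                    (q^ (y (statsB st))) (q^ (y (statsC st))))
factorise eBD st (cB , _) rewrite z≡x+δ cB =
  ≋-trans
    (solve 7 (λ A B C q Qx Qδ Qy →
       knₚ A (B ·qₚ (q :* Qx)) (A ·qₚ⁻ Qδ) :* kdₚ A (A ·qₚ Qδ) (C ·qₚ (q :* Qy))
       := (−A²ₚ A :* (1ₚ :- Qδ)) :* (1ₚ :* (atomₚ A B (q :* (Qx :* Qδ)) :* atomₚ A C (q :* Qy))))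
     ≋-refl A B C q (q^ (x (statsB st))) (q^ (δ st)) (q^ (y (statsC st))))
    (⊗-cong ≋-refl (⊗-cong ≋-refl
      (⊗-cong (⊗-cong (≋-sym (atom-suc-+ B (x (statsB st)) (δ st))) ≋-refl) ≋-refl)))
factorise eCD st (_ , cC) rewrite z≡x+δ cC =
  ≋-trans
    (solve 7 (λ A B C q Qx Qδ Qy →
       knₚ A (C ·qₚ (q :* Qx)) (A ·qₚ⁻ Qδ) :* kdₚ A (A ·qₚ Qδ) (B ·qₚ (q :* Qy))
       := (−A²ₚ A :* (1ₚ :- Qδ)) :* (1ₚ :* (atomₚ A B (q :* Qy) :* atomₚ A C (q :* (Qx :* Qδ)))))
     ≋-refl A B C q (q^ (x (statsC st))) (q^ (δ st)) (q^ (y (statsB st))))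
    (⊗-cong ≋-refl (⊗-cong ≋-refl
      (⊗-cong ≋-refl (⊗-cong (≋-sym (atom-suc-+ C (x (statsC st)) (δ st))) ≋-refl))))

prefactor-mirror : ∀ l st → prefactor (τL l) (mirror st) ≋ prefactor l st
prefactor-mirror eAB st = ≋-refl
prefactor-mirror eAC st = ≋-refl
prefactor-mirror eAD st =
  solve 3 (λ A Qα Qδ →
    ((A :* A) :* (A :* A)) :* ((1ₚ :- (Qδ :* Qα)) :* ((1ₚ :- Qδ) :* (1ₚ :- Qα)))
    := ((A :* A) :* (A :* A)) :* ((1ₚ :- (Qα :* Qδ)) :* ((1ₚ :- Qα) :* (1ₚ :- Qδ))))
  ≋-refl A (q^ (α st)) (q^ (δ st))
prefactor-mirror eBC st = ≋-refl
prefactor-mirror eBD st = ≋-refl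
prefactor-mirror eCD st = ≋-refl

-- Telescoping

-- Two potentials keep the step identity free of subtraction.
telescope-walk : (f h : Zipper → ℕ) (Φ Ψ : Word → Word → ℕ) →
  (∀ rp l s → f (rp ◂ l ▸ s) + Φ rp (l ∷ s) + Ψ (l ∷ rp) s
            ≡ h (rp ◂ l ▸ s) + Φ (l ∷ rp) s + Ψ rp (l ∷ s)) →
  ∀ rp s → sum (map f (zippers rp s)) + Φ rp s + Ψ (s ʳ++ rp) []
         ≡ sum (map h (zippers rp s)) + Φ (s ʳ++ rp) [] + Ψ rp s
telescope-walk f h Φ Ψ step rp []      = refl
telescope-walk f h Φ Ψ step rp (l ∷ s) = ℕ.+-cancelʳ-≡ (Φ₁ + Ψ₁) _ _ (begin
  (F + ΣF) + Φ₀ + Ψₑ + (Φ₁ + Ψ₁)  ≡⟨ split F Φ₀ Ψ₁ ΣF Φ₁ Ψₑ ⟩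
  (F + Φ₀ + Ψ₁) + (ΣF + Φ₁ + Ψₑ)  ≡⟨ cong₂ _+_ (step rp l s) (telescope-walk f h Φ Ψ step (l ∷ rp) s) ⟩
  (H + Φ₁ + Ψ₀) + (ΣH + Φₑ + Ψ₁)  ≡⟨ merge H Φ₁ Ψ₀ ΣH Φₑ Ψ₁ ⟩
  (H + ΣH) + Φₑ + Ψ₀ + (Φ₁ + Ψ₁)  ∎)
  where
  open ≡-Reasoning
  F H ΣF ΣH Φ₀ Ψ₀ Φ₁ Ψ₁ Φₑ Ψₑ : ℕ
  F = f (rp ◂ l ▸ s)
  H = h (rp ◂ l ▸ s)
  ΣF = sum (map f (zippers (l ∷ rp) s))
  ΣH = sum (map h (zippers (l ∷ rp) s))
  Φ₀ = Φ rp (l ∷ s)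
  Ψ₀ = Ψ rp (l ∷ s)
  Φ₁ = Φ (l ∷ rp) s
  Ψ₁ = Ψ (l ∷ rp) s
  Φₑ = Φ (s ʳ++ l ∷ rp) []
  Ψₑ = Ψ (s ʳ++ l ∷ rp) []
  split : ∀ a b c d e k → (a + d) + b + k + (e + c) ≡ (a + b + c) + (d + e + k)
  split = solve-∀
  merge : ∀ a b c d e k → (a + b + c) + (d + e + k) ≡ (a + d) + e + c + (b + k)
  merge = solve-∀

telescope : (f h : Zipper → ℕ) (Φ Ψ : Word → Word → ℕ) →
  (∀ rp l s → f (rp ◂ l ▸ s) + Φ rp (l ∷ s) + Ψ (l ∷ rp) s
            ≡ h (rp ◂ l ▸ s) + Φ (l ∷ rp) s + Ψ rp (l ∷ s)) →
  (∀ s → Φ [] s ≡ Ψ [] s) → (∀ rp → Φ rp [] ≡ Ψ rp []) →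
  ∀ w → sum (map f (zippers [] w)) ≡ sum (map h (zippers [] w))
telescope f h Φ Ψ step start end w = ℕ.+-cancelʳ-≡ (Φ [] w + Ψ (w ʳ++ []) []) _ _ (begin
  ΣF + (Φ [] w + Ψ (w ʳ++ []) [])  ≡⟨ ℕ.+-assoc ΣF (Φ [] w) _ ⟨
  ΣF + Φ [] w + Ψ (w ʳ++ []) []    ≡⟨ telescope-walk f h Φ Ψ step [] w ⟩
  ΣH + Φ (w ʳ++ []) [] + Ψ [] w    ≡⟨ cong₂ (λ a b → ΣH + a + b) (end (w ʳ++ [])) (sym (start w)) ⟩
  ΣH + Ψ (w ʳ++ []) [] + Φ [] w    ≡⟨ +ℕ.xy∙z≈x∙zy ΣH _ _ ⟩
  ΣH + (Φ [] w + Ψ (w ʳ++ []) [])  ∎)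
  where
  open ≡-Reasoning
  ΣF ΣH : ℕ
  ΣF = sum (map f (zippers [] w))
  ΣH = sum (map h (zippers [] w))

q-balanced : ∀ w → sum (map (λ z → qExponent (focus z) (statsAt z)) (zippers [] w))
                 ≡ sum (map (λ z → qExponent (τL (focus z)) (mirror (statsAt z))) (zippers [] w))
q-balanced = telescope _ _ (λ _ _ → 0) (λ rp s → count isBC-BD-CD rp * count isAB-AC-BC s)
  step (λ _ → refl) (λ rp → sym (ℕ.*-zeroʳ (count isBC-BD-CD rp)))
  where
  step : ∀ rp l s →
    qExponent l (gapStats rp s) + 0 + count isBC-BD-CD (l ∷ rp) * count isAB-AC-BC s
    ≡ qExponent (τL l) (mirror (gapStats rp s)) + 0 + count isBC-BD-CD rp * count isAB-AC-BC (l ∷ s)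
  step rp eAB s = pairs₁ (count isBC-BD-CD rp) (count isAB-AC-BC s)
    where pairs₁ : ∀ a d → a + 0 + a * d ≡ 0 + 0 + a * suc d
          pairs₁ = solve-∀
  step rp eAC s = step rp eAB s
  step rp eAD s = refl
  step rp eBC s = pairs₂ (count isBC-BD-CD rp) (count isAB-AC-BC s)
    where pairs₂ : ∀ a d → a + 0 + suc a * d ≡ d + 0 + a * suc d
          pairs₂ = solve-∀
  step rp eBD s = pairs₃ (count isBC-BD-CD rp) (count isAB-AC-BC s)
    where pairs₃ : ∀ a d → 0 + 0 + suc a * d ≡ d + 0 + a * d
          pairs₃ = solve-∀
  step rp eCD s = step rp eBD s

oneTo : ℕ → List ℕ
oneTo zero    = []
oneTo (suc n) = suc n ∷ oneTo n

bump : ℕ → Bool → ℕ → ℕ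
bump v b n = if b then hit v (suc n) else 0

oneTo-ind : ∀ v b n → mult v (oneTo (ind b + n)) ≡ bump v b n + mult v (oneTo n)
oneTo-ind v true  n = refl
oneTo-ind v false n = refl

oneTo-growˡ : ∀ v P Q l rp s →
  mult v (oneTo (count P (l ∷ rp) + count Q s))
  ≡ bump v (P l) (count P rp + count Q s) + mult v (oneTo (count P rp + count Q s))
oneTo-growˡ v P Q l rp s = trans
  (cong (λ n → mult v (oneTo n)) (trans (cong (_+ count Q s) (count-∷ P l rp)) (ℕ.+-assoc (ind (P l)) _ _)))
  (oneTo-ind v (P l) _)

oneTo-growʳ : ∀ v P Q l rp s →
  mult v (oneTo (count P rp + count Q (l ∷ s)))
  ≡ bump v (Q l) (count P rp + count Q s) + mult v (oneTo (count P rp + count Q s))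
oneTo-growʳ v P Q l rp s = trans
  (cong (λ n → mult v (oneTo n))
        (trans (cong (count P rp +_) (count-∷ Q l s)) (+ℕ.x∙yz≈y∙xz (count P rp) (ind (Q l)) _)))
  (oneTo-ind v (Q l) _)

Φᵖ Ψᵖ : ℕ → PairStats → ℕ
Φᵖ v p = mult v (oneTo (g p)) + mult v (oneTo (z p))
Ψᵖ v p = mult v (oneTo (x p)) + mult v (oneTo (y p))

module _ (v : ℕ) (P Q P′ Q′ : Letter → Bool) (rp : Word) (l : Letter) (s : Word) where
  private
    p : PairStats
    p = pairStats P Q P′ Q′ rp s
    H : ℕ → ℕ
    H n = mult v (oneTo n)

  Φᵖ-growˡ : Φᵖ v (pairStats P Q P′ Q′ (l ∷ rp) s)
             ≡ (bump v (P l) (g p) + H (g p)) + (bump v (P′ l) (z p) + H (z p))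
  Φᵖ-growˡ = cong₂ _+_ (oneTo-growˡ v P Q l rp s) (oneTo-growˡ v P′ Q′ l rp s)

  Ψᵖ-growˡ : Ψᵖ v (pairStats P Q P′ Q′ (l ∷ rp) s)
             ≡ (bump v (P′ l) (x p) + H (x p)) + (bump v (P l) (y p) + H (y p))
  Ψᵖ-growˡ = cong₂ _+_ (oneTo-growˡ v P′ Q l rp s) (oneTo-growˡ v P Q′ l rp s)

  Φᵖ-growʳ : Φᵖ v (pairStats P Q P′ Q′ rp (l ∷ s))
             ≡ (bump v (Q l) (g p) + H (g p)) + (bump v (Q′ l) (z p) + H (z p))
  Φᵖ-growʳ = cong₂ _+_ (oneTo-growʳ v P Q l rp s) (oneTo-growʳ v P′ Q′ l rp s)

  Ψᵖ-growʳ : Ψᵖ v (pairStats P Q P′ Q′ rp (l ∷ s))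
             ≡ (bump v (Q l) (x p) + H (x p)) + (bump v (Q′ l) (y p) + H (y p))
  Ψᵖ-growʳ = cong₂ _+_ (oneTo-growʳ v P′ Q l rp s) (oneTo-growʳ v P Q′ l rp s)

-- The step of `telescope` for one family of atoms, with the unchanged parts of the potentials
-- abstracted as hg, hx, hy, hz.
StepBalance : (P Q P′ Q′ : Letter → Bool) → (Letter → Letter) → Set
StepBalance P Q P′ Q′ ρ = ∀ v m p (hg hx hy hz : ℕ) →
  mult v (atoms (ρ m) p) + ((bump v (Q m) (g p) + hg) + (bump v (Q′ m) (z p) + hz))
                         + ((bump v (P′ m) (x p) + hx) + (bump v (P m) (y p) + hy))
  ≡ mult v (atoms (ρ (τL m)) (mirrorᵖ p)) + ((bump v (P m) (g p) + hg) + (bump v (P′ m) (z p) + hz))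
                                         + ((bump v (Q m) (x p) + hx) + (bump v (Q′ m) (y p) + hy))

stepBalanceB : StepBalance isAB isCD notAC-AD notBD-AD id
stepBalanceB v eAB p hg hx hy hz =
  rearrange (hit v (suc (g p))) (hit v (suc (x p))) (hit v (suc (y p))) (hit v (suc (z p))) hg hx hy hz
  where
  rearrange : ∀ eg ex ey ez hg hx hy hz → (eg + 0) + ((0 + hg) + (ez + hz)) + ((ex + hx) + (ey + hy))
                                        ≡ (ex + 0) + ((eg + hg) + (ez + hz)) + ((0 + hx) + (ey + hy))
  rearrange = solve-∀
stepBalanceB v eAC p hg hx hy hz = rearrange (hit v (suc (y p))) (hit v (suc (z p))) hg hx hy hz
  where
  rearrange : ∀ ey ez hg hx hy hz → (ey + 0) + ((0 + hg) + (ez + hz)) + ((0 + hx) + (0 + hy))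
                                  ≡ (ez + 0) + ((0 + hg) + (0 + hz)) + ((0 + hx) + (ey + hy))
  rearrange = solve-∀
stepBalanceB v eAD p hg hx hy hz = refl
stepBalanceB v eBC p hg hx hy hz = rearrange (hit v (suc (x p))) (hit v (suc (y p))) (hit v (suc (z p))) hg hx hy hz
  where
  rearrange : ∀ ex ey ez hg hx hy hz → (ey + 0) + ((0 + hg) + (ez + hz)) + ((ex + hx) + (0 + hy))
                                     ≡ (ex + 0) + ((0 + hg) + (ez + hz)) + ((0 + hx) + (ey + hy))
  rearrange = solve-∀
stepBalanceB v eBD p hg hx hy hz = rearrange (hit v (suc (x p))) (hit v (suc (z p))) hg hx hy hz
  where
  rearrange : ∀ ex ez hg hx hy hz → (ez + 0) + ((0 + hg) + (0 + hz)) + ((ex + hx) + (0 + hy))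
                                  ≡ (ex + 0) + ((0 + hg) + (ez + hz)) + ((0 + hx) + (0 + hy))
  rearrange = solve-∀
stepBalanceB v eCD p hg hx hy hz =
  rearrange (hit v (suc (g p))) (hit v (suc (x p))) (hit v (suc (y p))) (hit v (suc (z p))) hg hx hy hz
  where
  rearrange : ∀ eg ex ey ez hg hx hy hz → (ey + 0) + ((eg + hg) + (ez + hz)) + ((ex + hx) + (0 + hy))
                                        ≡ (eg + 0) + ((0 + hg) + (ez + hz)) + ((ex + hx) + (ey + hy))
  rearrange = solve-∀

-- Exchanging the roles of B and C, which acts on letters by σ, turns the C-atoms into B-atoms.
stepBalanceC : StepBalance isAC isBD notAB-AD notCD-AD σ
stepBalanceC v eAB = stepBalanceB v eAC
stepBalanceC v eAC = stepBalanceB v eAB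
stepBalanceC v eAD = stepBalanceB v eAD
stepBalanceC v eBC = stepBalanceB v eBC
stepBalanceC v eBD = stepBalanceB v eCD
stepBalanceC v eCD = stepBalanceB v eBD

atoms-balanced : ∀ {P Q P′ Q′ ρ} → StepBalance P Q P′ Q′ ρ → ∀ w v →
  mult v (concatMap (λ z → atoms (ρ (focus z)) (pairStats P Q P′ Q′ (before z) (after z))) (zippers [] w))
  ≡ mult v (concatMap (λ z → atoms (ρ (τL (focus z))) (mirrorᵖ (pairStats P Q P′ Q′ (before z) (after z))))
                      (zippers [] w))
atoms-balanced {P} {Q} {P′} {Q′} {ρ} balance w v = begin
  mult v (concatMap (λ z → atoms (ρ (focus z)) (F (before z) (after z))) (zippers [] w))
    ≡⟨ mult-concatMap v _ (zippers [] w) ⟩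
  sum (map (λ z → mult v (atoms (ρ (focus z)) (F (before z) (after z)))) (zippers [] w))
    ≡⟨ telescope _ _ (λ rp s → Φᵖ v (F rp s)) (λ rp s → Ψᵖ v (F rp s))
         step (λ _ → refl) (λ rp → ℕ.+-comm (mult v (oneTo (count P rp + 0))) _) w ⟩
  sum (map (λ z → mult v (atoms (ρ (τL (focus z))) (mirrorᵖ (F (before z) (after z))))) (zippers [] w))
    ≡⟨ mult-concatMap v _ (zippers [] w) ⟨
  mult v (concatMap (λ z → atoms (ρ (τL (focus z))) (mirrorᵖ (F (before z) (after z)))) (zippers [] w))
    ∎
  where
  open ≡-Reasoning
  F : Word → Word → PairStats
  F = pairStats P Q P′ Q′
  step : ∀ rp l s → mult v (atoms (ρ l) (F rp s)) + Φᵖ v (F rp (l ∷ s)) + Ψᵖ v (F (l ∷ rp) s)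
                  ≡ mult v (atoms (ρ (τL l)) (mirrorᵖ (F rp s))) + Φᵖ v (F (l ∷ rp) s) + Ψᵖ v (F rp (l ∷ s))
  step rp l s = begin
    mult v (atoms (ρ l) (F rp s)) + Φᵖ v (F rp (l ∷ s)) + Ψᵖ v (F (l ∷ rp) s)
      ≡⟨ cong₂ (λ φ ψ → mult v (atoms (ρ l) (F rp s)) + φ + ψ)
               (Φᵖ-growʳ v P Q P′ Q′ rp l s) (Ψᵖ-growˡ v P Q P′ Q′ rp l s) ⟩
    _ ≡⟨ balance v l (F rp s) _ _ _ _ ⟩
    _ ≡⟨ cong₂ (λ φ ψ → mult v (atoms (ρ (τL l)) (mirrorᵖ (F rp s))) + φ + ψ)
               (Φᵖ-growˡ v P Q P′ Q′ rp l s) (Ψᵖ-growʳ v P Q P′ Q′ rp l s) ⟨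
    mult v (atoms (ρ (τL l)) (mirrorᵖ (F rp s))) + Φᵖ v (F (l ∷ rp) s) + Ψᵖ v (F rp (l ∷ s))
      ∎

leftFactor rightFactor : Zipper → Expr
leftFactor  z = factored (focus z) (statsAt z)
rightFactor z = factored (τL (focus z)) (mirror (statsAt z))

factorise-left : ∀ z → kn (interval z) ⊗ kd (interval (τᶻ z)) ≋ leftFactor z
factorise-left (rp ◂ l ▸ s) = ≋-trans
  (≡⇒≋ (cong₂ (λ u v → kn u ⊗ kd v) (interval-zipper rp l s) (interval-τᶻ rp l s)))
  (factorise l (gapStats rp s) (gapStats-consistent rp s))

factorise-right : ∀ z → kn (interval (τᶻ z)) ⊗ kd (interval z) ≋ rightFactor z
factorise-right (rp ◂ l ▸ s) = ≋-trans
  (≡⇒≋ (cong₂ (λ u v → kn u ⊗ kd v)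
         (interval-τᶻ rp l s) (trans (interval-zipper rp l s) (cong (λ m → intervalAt m st) (sym (τL-involutive l))))))
  (factorise (τL l) (mirror st) (mirror-consistent (gapStats-consistent rp s)))
  where
  st : Stats
  st = gapStats rp s

Lq-cross-left : ∀ w → num (Lq w) ⊗ den (Lq (τ w)) ≋ prod leftFactor (zippers [] w)
Lq-cross-left w = ≋-trans
  (⊗-cong (≡⇒≋ (trans (num-IqAA (intervals w)) (prod-intervals kn w)))
          (≋-trans (≡⇒≋ (den-IqAA (intervals (τ w)))) (prod-intervals-τ kd w)))
  (≋-trans (prod-⊗ _ _ (zippers [] w)) (prod-cong factorise-left (zippers [] w)))

Lq-cross-right : ∀ w → num (Lq (τ w)) ⊗ den (Lq w) ≋ prod rightFactor (zippers [] w)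
Lq-cross-right w = ≋-trans
  (⊗-cong (≋-trans (≡⇒≋ (num-IqAA (intervals (τ w)))) (prod-intervals-τ kn w))
          (≡⇒≋ (trans (den-IqAA (intervals w)) (prod-intervals kd w))))
  (≋-trans (prod-⊗ _ _ (zippers [] w)) (prod-cong factorise-right (zippers [] w)))

-- The cross-multiplied identity holds for every word; admissibility only makes the denominators nonzero.
theorem4p8 : (w : Word) → Admissible w → Lq w ≈K Lq (τ w)
theorem4p8 w _ = begin
  num (Lq w) ⊗ den (Lq (τ w))  ≈⟨ Lq-cross-left w ⟩
  prod leftFactor zs           ≈⟨ prod-atomForm _ _ _ _ zs ⟩
  atomForm _ _ _ _             ≈⟨ atomForm-cong (prod-cong (λ z → ≋-sym (prefactor-mirror (focus z) (statsAt z))) zs)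
                                                (q-balanced w)
                                                (atoms-balanced stepBalanceB w) (atoms-balanced stepBalanceC w) ⟩
  atomForm _ _ _ _             ≈⟨ prod-atomForm _ _ _ _ zs ⟨
  prod rightFactor zs          ≈⟨ Lq-cross-right w ⟨
  num (Lq (τ w)) ⊗ den (Lq w)  ∎
  where
  open ≋-Reasoning
  zs : List Zipper
  zs = zippers [] w
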